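{- Let $\mathcal{A}$ be a reflexive graph. Then every fan of $\mathcal{A}$ is a proposition if and only if every co-fan of $\mathcal{A}$ is a proposition.
   Context: Intensional Martin-Löf type theory with $\Pi,\Sigma$, identity types. A reflexive graph $\mathcal{A}$ consists of a type $|\mathcal{A}|$, edge types $x\approx_{\mathcal{A}}y$ for $x,y:|\mathcal{A}|$, and $\mathsf{rx}_{\mathcal{A}}(x):x\approx_{\mathcal{A}}x$. The fan of $x$ is $\sum_{y:|\mathcal{A}|}x\approx_{\mathcal{A}}y$ and the co-fan of $x$ is $\sum_{y:|\mathcal{A}|}y\approx_{\mathcal{A}}x$. -}

{-# OPTIONS --without-K #-}
module Defs where

open import Level using (Level; suc; _⊔_)
open import Data.Product using (Σ; Σ-syntax)
open import Relation.Binary.PropositionalEquality using (_≡_)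

record ReflexiveGraph (a e : Level) : Set (suc (a ⊔ e)) where
  field
    ∣_∣ : Set a
    _≈_ : ∣_∣ → ∣_∣ → Set e
    rx  : (x : ∣_∣) → x ≈ x

open ReflexiveGraph public

isProp : {ℓ : Level} → Set ℓ → Set ℓ
isProp A = (p q : A) → p ≡ q

fan : {a e : Level} (𝒜 : ReflexiveGraph a e) → ∣ 𝒜 ∣ → Set (a ⊔ e)
fan 𝒜 x = Σ[ y ∈ ∣ 𝒜 ∣ ] _≈_ 𝒜 x y

cofan : {a e : Level} (𝒜 : ReflexiveGraph a e) → ∣ 𝒜 ∣ → Set (a ⊔ e)
cofan 𝒜 x = Σ[ y ∈ ∣ 𝒜 ∣ ] _≈_ 𝒜 y x

{-# OPTIONS --without-K #-}
module Submission where

-- Both directions are one argument, since the co-fans of a graph are the fans of its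
-- opposite. If every fan is a proposition, an edge p : y ≈ x gives a path in the fan
-- of y from (y , rx y) to (x , p); path induction on it relates (y , p) to the
-- centre (x , rx x) of the co-fan of x, so any two elements of that co-fan are equal.

open import Defs
open import Level using (Level)
open import Data.Product using (_×_; _,_; proj₁; proj₂)
open import Function using (flip)
open import Relation.Binary.PropositionalEquality using (_≡_; refl; trans; sym)

opposite : {a e : Level} → ReflexiveGraph a e → ReflexiveGraph a e
opposite 𝒜 = record { ∣_∣ = ∣ 𝒜 ∣ ; _≈_ = flip (_≈_ 𝒜) ; rx = rx 𝒜 }

module _ {a e : Level} (𝒜 : ReflexiveGraph a e) where

  fan-path⇒cofan-path : {y : ∣ 𝒜 ∣} (w : fan 𝒜 y) → (y , rx 𝒜 y) ≡ w →
    _≡_ {A = cofan 𝒜 (proj₁ w)} (y , proj₂ w) (proj₁ w , rx 𝒜 (proj₁ w))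
  fan-path⇒cofan-path _ refl = refl

  isProp-fan⇒isProp-cofan : ((x : ∣ 𝒜 ∣) → isProp (fan 𝒜 x)) →
                            (x : ∣ 𝒜 ∣) → isProp (cofan 𝒜 x)
  isProp-fan⇒isProp-cofan fan-isProp x (y , p) (z , q) =
    trans (to-centre y p) (sym (to-centre z q))
    where
    to-centre : (y : ∣ 𝒜 ∣) (p : _≈_ 𝒜 y x) → _≡_ {A = cofan 𝒜 x} (y , p) (x , rx 𝒜 x)
    to-centre y p = fan-path⇒cofan-path (x , p) (fan-isProp y (y , rx 𝒜 y) (x , p))

mainTheorem17 : {a e : Level} (𝒜 : ReflexiveGraph a e) →
    (((x : ∣ 𝒜 ∣) → isProp (fan 𝒜 x)) → ((x : ∣ 𝒜 ∣) → isProp (cofan 𝒜 x)))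
    × (((x : ∣ 𝒜 ∣) → isProp (cofan 𝒜 x)) → ((x : ∣ 𝒜 ∣) → isProp (fan 𝒜 x)))
mainTheorem17 𝒜 = isProp-fan⇒isProp-cofan 𝒜 , isProp-fan⇒isProp-cofan (opposite 𝒜)
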